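{- Let $B_1=\{231,312,1432\}$. For every positive integer $n$ and every nonnegative integer $k$, the number of permutations in $\operatorname{Av}_n(B_1)$ with exactly $k$ inversions is $$\sum_{\ell=1}^{n}\binom{n-\ell-\left(k-\binom{\ell}{2}\right)}{k-\binom{\ell}{2}}.$$
   Context: $\operatorname{Av}_n(S)$ is the set of permutations of length $n$ avoiding every pattern in $S$ (classical pattern avoidance). An inversion of a permutation $\pi$ is a pair of positions $i<j$ with $\pi_i>\pi_j$. Binomial coefficients $\binom{a}{b}$ with integer arguments are taken to be $0$ unless $0\le b\le a$. -}

module Defs where

open import Data.Nat using (ℕ; zero; suc; _+_; _*_; _<_; _<?_; _≟_)
open import Data.Integer as ℤ using (ℤ; +_)
open import Data.Bool using (Bool; true; false; _∧_; _∨_; not)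
open import Data.List using (List; []; _∷_; map; concatMap; filter; length; upTo; _++_; zip)
open import Data.Product using (_,_)
open import Data.List.Relation.Unary.AllPairs using (allPairs?)
open import Relation.Nullary.Decidable using (⌊_⌋; ¬?)
open import Data.Nat.Combinatorics using (_C_)

-- A permutation of length n is represented in one-line notation as a list
-- of the values 0,1,…,n-1 (each exactly once).

words : ℕ → ℕ → List (List ℕ)
words n zero    = [] ∷ []
words n (suc m) = concatMap (λ w → map (_∷ w) (upTo n)) (words n m)

perms : ℕ → List (List ℕ)
perms n = filter (λ w → allPairs? (λ x y → ¬? (x ≟ y)) w) (words n n)

subseqs : {A : Set} → List A → List (List A)
subseqs []       = [] ∷ []
subseqs (x ∷ xs) = let r = subseqs xs in map (x ∷_) r ++ r

sameOrder : ℕ → ℕ → ℕ → ℕ → Bool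
sameOrder a b c d = ⌊ Data.Bool._≟_ ⌊ a <? b ⌋ ⌊ c <? d ⌋ ⌋

any : {A : Set} → (A → Bool) → List A → Bool
any p []       = false
any p (x ∷ xs) = p x ∨ any p xs

all : {A : Set} → (A → Bool) → List A → Bool
all p []       = true
all p (x ∷ xs) = p x ∧ all p xs

-- two equal-length lists are order-isomorphic (for lists of distinct entries)
orderIso : List ℕ → List ℕ → Bool
orderIso []       []       = true
orderIso (x ∷ xs) (y ∷ ys) =
  all (λ { (x' , y') → sameOrder x x' y y' }) (zip xs ys)
  ∧ orderIso xs ys
orderIso _ _ = false

contains : List ℕ → List ℕ → Bool
contains π σ = any (orderIso σ) (subseqs π)

avoidsAll : List (List ℕ) → List ℕ → Bool
avoidsAll S π = all (λ σ → not (contains π σ)) S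

Av : ℕ → List (List ℕ) → List (List ℕ)
Av n S = filter (λ π → avoidsAll S π Data.Bool.≟ true) (perms n)

inv : List ℕ → ℕ
inv []       = 0
inv (x ∷ xs) = length (filter (λ y → y <? x) xs) + inv xs

-- patterns written with values 1..m (as in the paper)
B₁ : List (List ℕ)
B₁ = (2 ∷ 3 ∷ 1 ∷ []) ∷ (3 ∷ 1 ∷ 2 ∷ []) ∷ (1 ∷ 4 ∷ 3 ∷ 2 ∷ []) ∷ []

countInv : ℕ → List (List ℕ) → ℕ → ℕ
countInv n S k = length (filter (λ π → inv π ≟ k) (Av n S))

-- binomial coefficient with integer arguments: 0 unless 0 ≤ b ≤ a
binomℤ : ℤ → ℤ → ℕ
binomℤ (+ a) (+ b) = a C b
binomℤ _ _ = 0

sumFrom1 : ℕ → (ℕ → ℕ) → ℕ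
sumFrom1 zero    f = 0
sumFrom1 (suc n) f = sumFrom1 n f + f (suc n)

rhs : ℕ → ℕ → ℕ
rhs n k = sumFrom1 n (λ ℓ →
  let j = (+ k) ℤ.- (+ (ℓ C 2)) in
  binomℤ (((+ n) ℤ.- (+ ℓ)) ℤ.- j) j)

-- In one-line notation on 0, …, N-1, a permutation avoiding 231 and 312 lists all entries below
-- its first entry a right after it, in decreasing order: π = (a a-1 … 1 0) τ with τ a permutation
-- of a+1, …, N-1. As every entry of τ exceeds a, π then avoids 1432 exactly when τ avoids 321,
-- and the permutations avoiding 231, 312 and 321 are the direct sums of blocks 1 and 21, i.e. the
-- tilings of a strip of length m = N-ℓ (ℓ = a+1) by monominoes and dominoes, each domino being one
-- inversion. The prefix contributes C(ℓ,2) inversions and C(m-j, j) tilings of length m have j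
-- dominoes, which gives the ℓ-th summand with j = k - C(ℓ,2).

module Submission where

open import Defs
open import Data.Bool using (Bool; true; false; not)
open import Data.Bool.Properties using (∧-conicalˡ; ∧-conicalʳ)
import Data.Bool as Bool
open import Data.Nat using (ℕ; zero; suc; _+_; _∸_; _≤_; _<_; _≟_; _<?_; _≤?_; z≤n; s≤s)
open import Data.Nat.Properties
open import Data.Nat.Combinatorics using (_C_; nC1≡n; nCk+nC[k+1]≡[n+1]C[k+1]; k>n⇒nCk≡0)
import Data.Integer as ℤ
open ℤ using (_⊖_)
import Data.Integer.Properties as ℤ
open import Data.List using (List; []; _∷_; [_]; map; filter; length; upTo; applyUpTo; downFrom; _++_)
open import Data.List.Properties
  using (length-++; length-applyUpTo; length-downFrom; ∷-injective; ++-cancelˡ;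
         filter-++; filter-all; filter-none; filter-accept; filter-reject)
open import Data.List.Membership.Propositional using (_∈_; _∉_)
open import Data.List.Membership.DecPropositional _≟_ using (_∈?_)
open import Data.List.Membership.Propositional.Properties
open import Data.List.Relation.Unary.Any using (here; there)
open import Data.List.Relation.Unary.All as All using (All; []; _∷_)
import Data.List.Relation.Unary.All.Properties as All
open import Data.List.Relation.Unary.AllPairs using ([]; _∷_; allPairs?)
import Data.List.Relation.Unary.AllPairs as AllPairs
import Data.List.Relation.Unary.AllPairs.Properties as AllPairs
open import Data.List.Relation.Unary.Unique.Propositional using (Unique)
import Data.List.Relation.Unary.Unique.Propositional.Properties as Unique
open import Data.List.Relation.Binary.Sublist.Propositional
  using (_⊆_; []; _∷_; _∷ʳ_; ⊆-refl; ⊆-trans; from∈; to∈; lookup)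
open import Data.List.Relation.Binary.Sublist.Propositional.Properties using (All-resp-⊆; ++⁺ˡ)
open import Data.Product using (∃-syntax; _×_; _,_; proj₁; proj₂)
open import Data.Sum using (_⊎_; inj₁; inj₂)
import Data.Sum as Sum
open import Data.Empty using (⊥; ⊥-elim)
open import Function using (_∘_)
open import Relation.Nullary using (¬_; yes; no; ¬?)
open import Relation.Binary.PropositionalEquality hiding ([_])

∈-∷-≢ : ∀ {A : Set} {v x : A} {xs} → v ∈ x ∷ xs → v ≢ x → v ∈ xs
∈-∷-≢ (here v≡x) v≢x = ⊥-elim (v≢x v≡x)
∈-∷-≢ (there v∈) _   = v∈

2nd∈ : ∀ {A : Set} {x y : A} {s xs} → x ∷ y ∷ s ⊆ xs → y ∈ xs
2nd∈ τ = lookup τ (there (here refl))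

∈-order : ∀ {A : Set} {u w : A} {ys} → u ≢ w → u ∈ ys → w ∈ ys → u ∷ w ∷ [] ⊆ ys ⊎ w ∷ u ∷ [] ⊆ ys
∈-order u≢w (here refl) (here refl) = ⊥-elim (u≢w refl)
∈-order u≢w (here refl) (there w∈)  = inj₁ (refl ∷ from∈ w∈)
∈-order u≢w (there u∈)  (here refl) = inj₂ (refl ∷ from∈ u∈)
∈-order u≢w (there u∈)  (there w∈)  = Sum.map (_ ∷ʳ_) (_ ∷ʳ_) (∈-order u≢w u∈ w∈)

⊆-unique : ∀ {A : Set} {s xs : List A} → s ⊆ xs → Unique xs → Unique s
⊆-unique []         []          = []
⊆-unique (_ ∷ʳ τ)   (_ ∷ u)     = ⊆-unique τ u
⊆-unique (refl ∷ τ) (x∉xs ∷ u)  = All-resp-⊆ τ x∉xs ∷ ⊆-unique τ u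

Unique-++⇒disjoint : ∀ {A : Set} (p : List A) {xs v} → Unique (p ++ xs) → v ∈ p → v ∉ xs
Unique-++⇒disjoint (x ∷ p) (x∉ ∷ _) (here refl) v∈xs = All.lookup x∉ (∈-++⁺ʳ p v∈xs) refl
Unique-++⇒disjoint (x ∷ p) (_ ∷ u)  (there v∈p) = Unique-++⇒disjoint p u v∈p

unique⇒length-mono-≤ : ∀ {A : Set} {xs ys : List A} → Unique xs → (∀ {z} → z ∈ xs → z ∈ ys) →
                       length xs ≤ length ys
unique⇒length-mono-≤ {xs = []}     _          _     = z≤n
unique⇒length-mono-≤ {xs = x ∷ xs} (x∉xs ∷ u) xs⊆ys with ∈-∃++ (xs⊆ys (here refl))
... | ys₁ , ys₂ , refl = begin
  suc (length xs)                ≤⟨ s≤s (unique⇒length-mono-≤ u xs⊆ys₁ys₂) ⟩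
  suc (length (ys₁ ++ ys₂))      ≡⟨ cong suc (length-++ ys₁) ⟩
  suc (length ys₁ + length ys₂)  ≡⟨ +-suc (length ys₁) (length ys₂) ⟨
  length ys₁ + length (x ∷ ys₂)  ≡⟨ length-++ ys₁ ⟨
  length (ys₁ ++ x ∷ ys₂)        ∎
  where
  open ≤-Reasoning
  xs⊆ys₁ys₂ : ∀ {z} → z ∈ xs → z ∈ ys₁ ++ ys₂
  xs⊆ys₁ys₂ z∈ with ∈-++⁻ ys₁ (xs⊆ys (there z∈))
  ... | inj₁ z∈ys₁          = ∈-++⁺ˡ z∈ys₁
  ... | inj₂ (here refl)    = ⊥-elim (All.lookup x∉xs z∈ refl)
  ... | inj₂ (there z∈ys₂)  = ∈-++⁺ʳ ys₁ z∈ys₂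

unique⇒length-≡ : ∀ {A : Set} {xs ys : List A} → Unique xs → Unique ys →
                  (∀ {z} → z ∈ xs → z ∈ ys) → (∀ {z} → z ∈ ys → z ∈ xs) → length xs ≡ length ys
unique⇒length-≡ uxs uys xs⊆ys ys⊆xs =
  ≤-antisym (unique⇒length-mono-≤ uxs xs⊆ys) (unique⇒length-mono-≤ uys ys⊆xs)

≮∧≢⇒> : ∀ {x y} → ¬ x < y → x ≢ y → y < x
≮∧≢⇒> x≮y x≢y = ≤∧≢⇒< (≮⇒≥ x≮y) (x≢y ∘ sym)

-- Pattern containment

∈-subseqs⁻ : ∀ {A : Set} {s : List A} xs → s ∈ subseqs xs → s ⊆ xs
∈-subseqs⁻ []       (here refl) = []
∈-subseqs⁻ (x ∷ xs) s∈ with ∈-++⁻ (map (x ∷_) (subseqs xs)) s∈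
... | inj₁ s∈kept with ∈-map⁻ (x ∷_) s∈kept
...   | t , t∈ , refl = refl ∷ ∈-subseqs⁻ xs t∈
∈-subseqs⁻ (x ∷ xs) s∈ | inj₂ s∈skipped = x ∷ʳ ∈-subseqs⁻ xs s∈skipped

∈-subseqs⁺ : ∀ {A : Set} {s xs : List A} → s ⊆ xs → s ∈ subseqs xs
∈-subseqs⁺ []                   = here refl
∈-subseqs⁺ {xs = x ∷ xs} (.x ∷ʳ τ) = ∈-++⁺ʳ (map (x ∷_) (subseqs xs)) (∈-subseqs⁺ τ)
∈-subseqs⁺ (refl ∷ τ)           = ∈-++⁺ˡ (∈-map⁺ _ (∈-subseqs⁺ τ))

any-true⁻ : ∀ {A : Set} (p : A → Bool) xs → any p xs ≡ true → ∃[ x ] x ∈ xs × p x ≡ true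
any-true⁻ p (x ∷ xs) h with p x in px
... | true  = x , here refl , px
... | false with any-true⁻ p xs h
...   | y , y∈ , py = y , there y∈ , py

any-true⁺ : ∀ {A : Set} (p : A → Bool) {x xs} → x ∈ xs → p x ≡ true → any p xs ≡ true
any-true⁺ p {xs = y ∷ ys} (here refl) px rewrite px = refl
any-true⁺ p {xs = y ∷ ys} (there x∈) px with p y
... | true  = refl
... | false = any-true⁺ p x∈ px

all-true⁻ : ∀ {A : Set} (p : A → Bool) xs → all p xs ≡ true → ∀ {x} → x ∈ xs → p x ≡ true
all-true⁻ p (x ∷ xs) h (here refl) = ∧-conicalˡ (p x) _ h
all-true⁻ p (x ∷ xs) h (there x∈)  = all-true⁻ p xs (∧-conicalʳ (p x) _ h) x∈

all-true⁺ : ∀ {A : Set} (p : A → Bool) xs → (∀ {x} → x ∈ xs → p x ≡ true) → all p xs ≡ true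
all-true⁺ p []       h = refl
all-true⁺ p (x ∷ xs) h rewrite h (here refl) = all-true⁺ p xs (h ∘ there)

orderIso⇒length≡ : ∀ σ s → orderIso σ s ≡ true → length s ≡ length σ
orderIso⇒length≡ []      []      _   = refl
orderIso⇒length≡ (_ ∷ σ) (_ ∷ s) iso = cong suc (orderIso⇒length≡ σ s (∧-conicalʳ _ _ iso))

Avoids : List ℕ → List ℕ → Set
Avoids σ π = ∀ {s} → s ⊆ π → orderIso σ s ≢ true

not-contains⇒avoids : ∀ π σ → not (contains π σ) ≡ true → Avoids σ π
not-contains⇒avoids π σ h τ iso rewrite any-true⁺ (orderIso σ) (∈-subseqs⁺ τ) iso with h
... | ()

avoids⇒not-contains : ∀ π σ → Avoids σ π → not (contains π σ) ≡ true
avoids⇒not-contains π σ av with contains π σ in c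
... | false = refl
... | true with any-true⁻ (orderIso σ) (subseqs π) c
...   | s , s∈ , iso = ⊥-elim (av (∈-subseqs⁻ π s∈) iso)

Avoids231 Avoids312 Avoids321 : List ℕ → Set
Avoids231 π = ∀ {a b c} → a ∷ b ∷ c ∷ [] ⊆ π → c < a → a < b → ⊥
Avoids312 π = ∀ {a b c} → a ∷ b ∷ c ∷ [] ⊆ π → b < c → c < a → ⊥
Avoids321 π = ∀ {a b c} → a ∷ b ∷ c ∷ [] ⊆ π → c < b → b < a → ⊥

Avoids1432 : List ℕ → Set
Avoids1432 π = ∀ {a b c d} → a ∷ b ∷ c ∷ d ∷ [] ⊆ π → a < d → d < c → c < b → ⊥

orderIso-231 : ∀ {a b c} → c < a → a < b → orderIso (2 ∷ 3 ∷ 1 ∷ []) (a ∷ b ∷ c ∷ []) ≡ true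
orderIso-231 {a} {b} {c} c<a a<b with a <? b | a <? c | b <? c
... | yes _   | no _    | no _    = refl
... | no a≮b  | _       | _       = ⊥-elim (a≮b a<b)
... | _       | yes a<c | _       = ⊥-elim (<-asym a<c c<a)
... | _       | _       | yes b<c = ⊥-elim (<-asym b<c (<-trans c<a a<b))

orderIso-231⁻ : ∀ {a b c} → a ≢ c → orderIso (2 ∷ 3 ∷ 1 ∷ []) (a ∷ b ∷ c ∷ []) ≡ true → c < a × a < b
orderIso-231⁻ {a} {b} {c} a≢c iso with a <? b | a <? c
orderIso-231⁻ a≢c iso | yes a<b | no a≮c = ≮∧≢⇒> a≮c a≢c , a<b
orderIso-231⁻ a≢c ()  | yes _   | yes _
orderIso-231⁻ a≢c ()  | no _    | _

orderIso-312 : ∀ {a b c} → b < c → c < a → orderIso (3 ∷ 1 ∷ 2 ∷ []) (a ∷ b ∷ c ∷ []) ≡ true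
orderIso-312 {a} {b} {c} b<c c<a with a <? b | a <? c | b <? c
... | no _    | no _    | yes _   = refl
... | yes a<b | _       | _       = ⊥-elim (<-asym a<b (<-trans b<c c<a))
... | _       | yes a<c | _       = ⊥-elim (<-asym a<c c<a)
... | _       | _       | no b≮c  = ⊥-elim (b≮c b<c)

orderIso-312⁻ : ∀ {a b c} → a ≢ c → orderIso (3 ∷ 1 ∷ 2 ∷ []) (a ∷ b ∷ c ∷ []) ≡ true → b < c × c < a
orderIso-312⁻ {a} {b} {c} a≢c iso with a <? b | a <? c | b <? c
orderIso-312⁻ a≢c iso | no _ | no a≮c | yes b<c = b<c , ≮∧≢⇒> a≮c a≢c
orderIso-312⁻ a≢c ()  | yes _ | _     | _
orderIso-312⁻ a≢c ()  | no _  | yes _ | _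
orderIso-312⁻ a≢c ()  | no _  | no _  | no _

orderIso-1432 : ∀ {a b c d} → a < d → d < c → c < b →
                orderIso (1 ∷ 4 ∷ 3 ∷ 2 ∷ []) (a ∷ b ∷ c ∷ d ∷ []) ≡ true
orderIso-1432 {a} {b} {c} {d} a<d d<c c<b
  with a <? b | a <? c | a <? d | b <? c | b <? d | c <? d
... | yes _ | yes _ | yes _ | no _ | no _ | no _ = refl
... | no a≮b | _ | _ | _ | _ | _ = ⊥-elim (a≮b (<-trans a<d (<-trans d<c c<b)))
... | _ | no a≮c | _ | _ | _ | _ = ⊥-elim (a≮c (<-trans a<d d<c))
... | _ | _ | no a≮d | _ | _ | _ = ⊥-elim (a≮d a<d)
... | _ | _ | _ | yes b<c | _ | _ = ⊥-elim (<-asym b<c c<b)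
... | _ | _ | _ | _ | yes b<d | _ = ⊥-elim (<-asym b<d (<-trans d<c c<b))
... | _ | _ | _ | _ | _ | yes c<d = ⊥-elim (<-asym c<d d<c)

orderIso-1432⁻ : ∀ {a b c d} → b ≢ c → c ≢ d →
                 orderIso (1 ∷ 4 ∷ 3 ∷ 2 ∷ []) (a ∷ b ∷ c ∷ d ∷ []) ≡ true → a < d × d < c × c < b
orderIso-1432⁻ {a} {b} {c} {d} b≢c c≢d iso
  with a <? b | a <? c | a <? d | b <? c | b <? d | c <? d
orderIso-1432⁻ b≢c c≢d iso | yes _ | yes _ | yes a<d | no b≮c | no _ | no c≮d =
  a<d , ≮∧≢⇒> c≮d c≢d , ≮∧≢⇒> b≮c b≢c
orderIso-1432⁻ b≢c c≢d () | no _  | _     | _     | _     | _     | _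
orderIso-1432⁻ b≢c c≢d () | yes _ | no _  | _     | _     | _     | _
orderIso-1432⁻ b≢c c≢d () | yes _ | yes _ | no _  | _     | _     | _
orderIso-1432⁻ b≢c c≢d () | yes _ | yes _ | yes _ | yes _ | _     | _
orderIso-1432⁻ b≢c c≢d () | yes _ | yes _ | yes _ | no _  | yes _ | _
orderIso-1432⁻ b≢c c≢d () | yes _ | yes _ | yes _ | no _  | no _  | yes _

AvoidsB₁ : List ℕ → Set
AvoidsB₁ π = Avoids231 π × Avoids312 π × Avoids1432 π

avoidsAll-B₁⁻ : ∀ π → avoidsAll B₁ π ≡ true → AvoidsB₁ π
avoidsAll-B₁⁻ π h =
  (λ τ c<a a<b → avoids (here refl) τ (orderIso-231 c<a a<b)) ,
  (λ τ b<c c<a → avoids (there (here refl)) τ (orderIso-312 b<c c<a)) ,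
  (λ τ a<d d<c c<b → avoids (there (there (here refl))) τ (orderIso-1432 a<d d<c c<b))
  where
  avoids : ∀ {σ} → σ ∈ B₁ → Avoids σ π
  avoids {σ} σ∈ = not-contains⇒avoids π σ (all-true⁻ (λ σ → not (contains π σ)) B₁ h σ∈)

avoidsAll-B₁⁺ : ∀ π → Unique π → AvoidsB₁ π → avoidsAll B₁ π ≡ true
avoidsAll-B₁⁺ π u (av231 , av312 , av1432) =
  all-true⁺ (λ σ → not (contains π σ)) B₁ λ {σ} σ∈ → avoids⇒not-contains π σ (avoids σ∈)
  where
  avoids : ∀ {σ} → σ ∈ B₁ → Avoids σ π
  avoids (here refl) {s} τ iso with orderIso⇒length≡ (2 ∷ 3 ∷ 1 ∷ []) s iso
  avoids (here refl) {a ∷ b ∷ c ∷ []} τ iso | refl with ⊆-unique τ u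
  ... | (_ ∷ a≢c ∷ []) ∷ _ = let c<a , a<b = orderIso-231⁻ a≢c iso in av231 τ c<a a<b
  avoids (there (here refl)) {s} τ iso with orderIso⇒length≡ (3 ∷ 1 ∷ 2 ∷ []) s iso
  avoids (there (here refl)) {a ∷ b ∷ c ∷ []} τ iso | refl with ⊆-unique τ u
  ... | (_ ∷ a≢c ∷ []) ∷ _ = let b<c , c<a = orderIso-312⁻ a≢c iso in av312 τ b<c c<a
  avoids (there (there (here refl))) {s} τ iso with orderIso⇒length≡ (1 ∷ 4 ∷ 3 ∷ 2 ∷ []) s iso
  avoids (there (there (here refl))) {a ∷ b ∷ c ∷ d ∷ []} τ iso | refl with ⊆-unique τ u
  ... | _ ∷ (b≢c ∷ _) ∷ (c≢d ∷ []) ∷ _ =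
    let a<d , d<c , c<b = orderIso-1432⁻ b≢c c≢d iso in av1432 τ a<d d<c c<b

-- Permutations of an interval

InRange : ℕ → ℕ → ℕ → Set
InRange o m v = o ≤ v × v < o + m

record IsPermOf (o m : ℕ) (xs : List ℕ) : Set where
  constructor isPermOf
  field
    length≡ : length xs ≡ m
    inRange : All (InRange o m) xs
    unique  : Unique xs

InRange-suc : ∀ {o m v} → InRange (suc o) m v → InRange o (suc m) v
InRange-suc {o} {m} {v} (o<v , v<) = <⇒≤ o<v , subst (v <_) (sym (+-suc o m)) v<

InRange-min : ∀ o m → InRange o (suc m) o
InRange-min o m = ≤-refl , m<m+n o (s≤s z≤n)

InRange-2nd : ∀ o m → InRange o (suc (suc m)) (suc o)
InRange-2nd o m = InRange-suc (InRange-min (suc o) m)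

∈-applyUpTo-+ : ∀ {o m v} → InRange o m v → v ∈ applyUpTo (o +_) m
∈-applyUpTo-+ {o} {m} (o≤v , v<o+m) rewrite sym (m+[n∸m]≡n o≤v) =
  ∈-applyUpTo⁺ (o +_) (+-cancelˡ-< o _ _ v<o+m)

-- pigeonhole
IsPermOf⇒∈ : ∀ {o m xs v} → IsPermOf o m xs → InRange o m v → v ∈ xs
IsPermOf⇒∈ {o} {m} {xs} {v} (isPermOf len range u) v∈range with v ∈? xs
... | yes v∈xs = v∈xs
... | no  v∉xs = ⊥-elim (<-irrefl refl (begin-strict
  length xs                    <⟨ n<1+n (length xs) ⟩
  length (v ∷ xs)              ≤⟨ unique⇒length-mono-≤ (v≢xs ∷ u) v∷xs⊆range ⟩
  length (applyUpTo (o +_) m)  ≡⟨ length-applyUpTo (o +_) m ⟩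
  m                            ≡⟨ len ⟨
  length xs                    ∎))
  where
  open ≤-Reasoning
  v≢xs : All (v ≢_) xs
  v≢xs = All.tabulate λ w∈ v≡w → v∉xs (subst (_∈ xs) (sym v≡w) w∈)
  v∷xs⊆range : ∀ {z} → z ∈ v ∷ xs → z ∈ applyUpTo (o +_) m
  v∷xs⊆range (here refl) = ∈-applyUpTo-+ v∈range
  v∷xs⊆range (there z∈)  = ∈-applyUpTo-+ (All.lookup range z∈)

IsPermOf-downFrom : ∀ k → IsPermOf 0 k (downFrom k)
IsPermOf-downFrom k = isPermOf (length-downFrom k) (All.tabulate ((z≤n ,_) ∘ ∈-downFrom⁻)) (Unique.downFrom⁺ k)

IsPermOf-++⁺ : ∀ {o k m p xs} → IsPermOf o k p → IsPermOf (k + o) m xs → IsPermOf o (k + m) (p ++ xs)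
IsPermOf-++⁺ {o} {k} {m} {p} {xs} (isPermOf lenp rangep up) (isPermOf lenxs rangexs uxs) =
  isPermOf (trans (length-++ p) (cong₂ _+_ lenp lenxs))
           (All.++⁺ (All.map widen rangep) (All.map shift rangexs))
           (Unique.++⁺ up uxs disjoint)
  where
  widen : ∀ {v} → InRange o k v → InRange o (k + m) v
  widen (o≤v , v<o+k) = o≤v , <-≤-trans v<o+k (+-monoʳ-≤ o (m≤m+n k m))
  shift : ∀ {v} → InRange (k + o) m v → InRange o (k + m) v
  shift (k+o≤v , v<k+o+m) =
    ≤-trans (m≤n+m o k) k+o≤v , <-≤-trans v<k+o+m (≤-reflexive (trans (cong (_+ m) (+-comm k o)) (+-assoc o k m)))
  disjoint : ∀ {v} → ¬ (v ∈ p × v ∈ xs)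
  disjoint (v∈p , v∈xs) =
    <⇒≱ (proj₂ (All.lookup rangep v∈p)) (≤-trans (≤-reflexive (+-comm o k)) (proj₁ (All.lookup rangexs v∈xs)))

IsPermOf-++⁻ : ∀ {o k m} p {xs} → IsPermOf o k p → IsPermOf o (k + m) (p ++ xs) → IsPermOf (k + o) m xs
IsPermOf-++⁻ {o} {k} {m} p {xs} permP (isPermOf len range u) =
  isPermOf len′ (All.tabulate range′) (⊆-unique (++⁺ˡ p ⊆-refl) u)
  where
  len′ : length xs ≡ m
  len′ = +-cancelˡ-≡ k _ _ (begin
    k + length xs         ≡⟨ cong (_+ length xs) (IsPermOf.length≡ permP) ⟨
    length p + length xs  ≡⟨ length-++ p ⟨
    length (p ++ xs)      ≡⟨ len ⟩
    k + m                 ∎)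
    where open ≡-Reasoning
  range′ : ∀ {v} → v ∈ xs → InRange (k + o) m v
  range′ {v} v∈xs with All.lookup range (∈-++⁺ʳ p v∈xs)
  ... | o≤v , v<o+k+m = ≮⇒≥ v∉p , subst (v <_) (trans (sym (+-assoc o k m)) (cong (_+ m) (+-comm o k))) v<o+k+m
    where
    v∉p : ¬ v < k + o
    v∉p v<k+o = Unique-++⇒disjoint p u (IsPermOf⇒∈ permP (o≤v , subst (v <_) (+-comm k o) v<k+o)) v∈xs

∈-words⁻ : ∀ n m {w} → w ∈ words n m → length w ≡ m × All (_< n) w
∈-words⁻ n zero    (here refl) = refl , []
∈-words⁻ n (suc m) w∈ with ∈-concat⁻′ (map (λ v → map (_∷ v) (upTo n)) (words n m)) w∈
... | _ , w∈block , block∈ with ∈-map⁻ (λ v → map (_∷ v) (upTo n)) block∈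
...   | v , v∈ , refl with ∈-map⁻ (_∷ v) w∈block
...     | a , a∈ , refl with ∈-words⁻ n m v∈
...       | len , v<n = cong suc len , ∈-upTo⁻ a∈ ∷ v<n

∈-words⁺ : ∀ n m {w} → length w ≡ m → All (_< n) w → w ∈ words n m
∈-words⁺ n zero    {[]}    refl []         = here refl
∈-words⁺ n (suc m) {a ∷ v} len (a<n ∷ v<n) =
  ∈-concat⁺′ (∈-map⁺ (_∷ v) (∈-upTo⁺ a<n))
             (∈-map⁺ (λ v → map (_∷ v) (upTo n)) (∈-words⁺ n m (suc-injective len) v<n))

words-unique : ∀ n m → Unique (words n m)
words-unique n zero    = [] ∷ []
words-unique n (suc m) =
  Unique.concat⁺ (All.tabulate block-unique)
                 (AllPairs.map⁺ (AllPairs.map blocks-disjoint (words-unique n m)))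
  where
  block-unique : ∀ {block} → block ∈ map (λ v → map (_∷ v) (upTo n)) (words n m) → Unique block
  block-unique block∈ with ∈-map⁻ (λ v → map (_∷ v) (upTo n)) block∈
  ... | _ , _ , refl = Unique.map⁺ (proj₁ ∘ ∷-injective) (Unique.upTo⁺ n)
  blocks-disjoint : ∀ {v v′} → v ≢ v′ → ∀ {w} → ¬ (w ∈ map (_∷ v) (upTo n) × w ∈ map (_∷ v′) (upTo n))
  blocks-disjoint v≢v′ (w∈ , w∈′) with ∈-map⁻ (_∷ _) w∈ | ∈-map⁻ (_∷ _) w∈′
  ... | _ , _ , refl | _ , _ , eq = v≢v′ (proj₂ (∷-injective eq))

∈-Av⁻ : ∀ n {π} → π ∈ Av n B₁ → IsPermOf 0 n π × AvoidsB₁ π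
∈-Av⁻ n {π} π∈ with ∈-filter⁻ (λ π → avoidsAll B₁ π Bool.≟ true) {xs = perms n} π∈
... | π∈perms , avoids with ∈-filter⁻ (λ w → allPairs? (λ x y → ¬? (x ≟ y)) w) {xs = words n n} π∈perms
...   | π∈words , u with ∈-words⁻ n n π∈words
...     | len , π<n = isPermOf len (All.map (z≤n ,_) π<n) u , avoidsAll-B₁⁻ π avoids

∈-Av⁺ : ∀ n {π} → IsPermOf 0 n π → AvoidsB₁ π → π ∈ Av n B₁
∈-Av⁺ n {π} (isPermOf len range u) av =
  ∈-filter⁺ (λ π → avoidsAll B₁ π Bool.≟ true)
    (∈-filter⁺ (λ w → allPairs? (λ x y → ¬? (x ≟ y)) w) (∈-words⁺ n n len (All.map proj₂ range)) u)
    (avoidsAll-B₁⁺ π u av)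

Av-unique : ∀ n → Unique (Av n B₁)
Av-unique n = Unique.filter⁺ _ (Unique.filter⁺ _ (words-unique n n))

-- Tilings by monominoes and dominoes

domino : ℕ → List ℕ → List ℕ
domino o τ = suc o ∷ o ∷ τ

-- the direct sums of blocks 1 and 21 on the values o, o+1, …, o+m-1
tilings : ℕ → ℕ → List (List ℕ)
tilings o zero          = [ [] ]
tilings o (suc zero)    = [ [ o ] ]
tilings o (suc (suc m)) =
  map (o ∷_) (tilings (suc o) (suc m)) ++ map (domino o) (tilings (suc (suc o)) m)

Avoids231-312-321 : List ℕ → Set
Avoids231-312-321 π = Avoids231 π × Avoids312 π × Avoids321 π

IsPermOf-∷-min : ∀ {o m τ} → IsPermOf (suc o) m τ → IsPermOf o (suc m) (o ∷ τ)
IsPermOf-∷-min {o} {m} (isPermOf len range u) =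
  isPermOf (cong suc len) (InRange-min o m ∷ All.map InRange-suc range) (All.map (<⇒≢ ∘ proj₁) range ∷ u)

IsPermOf-domino : ∀ {o m τ} → IsPermOf (suc (suc o)) m τ → IsPermOf o (suc (suc m)) (domino o τ)
IsPermOf-domino {o} {m} (isPermOf len range u) =
  isPermOf (cong (suc ∘ suc) len)
           (InRange-suc (InRange-min (suc o) m) ∷ InRange-min o (suc m) ∷ All.map (InRange-suc ∘ InRange-suc) range)
           (((λ ()) ∷ All.map (<⇒≢ ∘ proj₁) range) ∷ All.map (λ r → <⇒≢ (<-trans (n<1+n o) (proj₁ r))) range ∷ u)

∈-above⇒≮ : ∀ {x y τ} → All (x <_) τ → y ∈ τ → y < x → ⊥
∈-above⇒≮ x<τ y∈τ y<x = <-asym y<x (All.lookup x<τ y∈τ)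

avoids-∷-min : ∀ {x τ} → All (x <_) τ → Avoids231-312-321 τ → Avoids231-312-321 (x ∷ τ)
avoids-∷-min {x} {τ} x<τ (av231 , av312 , av321) = av231′ , av312′ , av321′
  where
  av231′ : Avoids231 (x ∷ τ)
  av231′ (refl ∷ τ′) c<a _   = ∈-above⇒≮ x<τ (2nd∈ τ′) c<a
  av231′ (_ ∷ʳ τ′)   c<a a<b = av231 τ′ c<a a<b
  av312′ : Avoids312 (x ∷ τ)
  av312′ (refl ∷ τ′) b<c c<a = ∈-above⇒≮ x<τ (to∈ τ′) (<-trans b<c c<a)
  av312′ (_ ∷ʳ τ′)   b<c c<a = av312 τ′ b<c c<a
  av321′ : Avoids321 (x ∷ τ)
  av321′ (refl ∷ τ′) _   b<a = ∈-above⇒≮ x<τ (to∈ τ′) b<a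
  av321′ (_ ∷ʳ τ′)   c<b b<a = av321 τ′ c<b b<a

avoids-domino : ∀ {o τ} → All (suc o <_) τ → Avoids231-312-321 τ → Avoids231-312-321 (domino o τ)
avoids-domino {o} {τ} o+1<τ av with avoids-∷-min (All.map (<-trans (n<1+n o)) o+1<τ) av
... | av231 , av312 , av321 = av231′ , av312′ , av321′
  where
  av231′ : Avoids231 (domino o τ)
  av231′ (refl ∷ refl ∷ _)   _   a<b = <-asym a<b (n<1+n o)
  av231′ (refl ∷ _ ∷ʳ τ′)    c<a _   = ∈-above⇒≮ o+1<τ (2nd∈ τ′) c<a
  av231′ (_ ∷ʳ τ′)           c<a a<b = av231 τ′ c<a a<b
  av312′ : Avoids312 (domino o τ)
  av312′ (refl ∷ refl ∷ τ′)  _   c<a = ∈-above⇒≮ o+1<τ (to∈ τ′) c<a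
  av312′ (refl ∷ _ ∷ʳ τ′)    b<c c<a = ∈-above⇒≮ o+1<τ (to∈ τ′) (<-trans b<c c<a)
  av312′ (_ ∷ʳ τ′)           b<c c<a = av312 τ′ b<c c<a
  av321′ : Avoids321 (domino o τ)
  av321′ (refl ∷ refl ∷ τ′)  c<b _   = ∈-above⇒≮ o+1<τ (to∈ τ′) (<-trans c<b (n<1+n o))
  av321′ (refl ∷ _ ∷ʳ τ′)    _   b<a = ∈-above⇒≮ o+1<τ (to∈ τ′) b<a
  av321′ (_ ∷ʳ τ′)           c<b b<a = av321 τ′ c<b b<a

avoids-∷⁻ : ∀ {x τ} → Avoids231-312-321 (x ∷ τ) → Avoids231-312-321 τ
avoids-∷⁻ {x} (av231 , av312 , av321) = av231 ∘ (x ∷ʳ_) , av312 ∘ (x ∷ʳ_) , av321 ∘ (x ∷ʳ_)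

∈-tilings⇒IsPermOf : ∀ o m {τ} → τ ∈ tilings o m → IsPermOf o m τ
∈-tilings⇒IsPermOf o zero          (here refl) = isPermOf refl [] []
∈-tilings⇒IsPermOf o (suc zero)    (here refl) = IsPermOf-∷-min (isPermOf refl [] [])
∈-tilings⇒IsPermOf o (suc (suc m)) τ∈ with ∈-++⁻ (map (o ∷_) (tilings (suc o) (suc m))) τ∈
... | inj₁ τ∈₁ with ∈-map⁻ (o ∷_) τ∈₁
...   | _ , τ′∈ , refl = IsPermOf-∷-min (∈-tilings⇒IsPermOf (suc o) (suc m) τ′∈)
∈-tilings⇒IsPermOf o (suc (suc m)) τ∈ | inj₂ τ∈₂ with ∈-map⁻ (domino o) τ∈₂
...   | _ , τ′∈ , refl = IsPermOf-domino (∈-tilings⇒IsPermOf (suc (suc o)) m τ′∈)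

∈-tilings⇒≥ : ∀ o m {τ} → τ ∈ tilings o m → All (o ≤_) τ
∈-tilings⇒≥ o m τ∈ = All.map proj₁ (IsPermOf.inRange (∈-tilings⇒IsPermOf o m τ∈))

∈-tilings⇒avoids : ∀ o m {τ} → τ ∈ tilings o m → Avoids231-312-321 τ
∈-tilings⇒avoids o zero          (here refl) = (λ ()) , (λ ()) , (λ ())
∈-tilings⇒avoids o (suc zero)    (here refl) = avoids-∷-min [] ((λ ()) , (λ ()) , (λ ()))
∈-tilings⇒avoids o (suc (suc m)) τ∈ with ∈-++⁻ (map (o ∷_) (tilings (suc o) (suc m))) τ∈
... | inj₁ τ∈₁ with ∈-map⁻ (o ∷_) τ∈₁
...   | _ , τ′∈ , refl = avoids-∷-min (∈-tilings⇒≥ (suc o) (suc m) τ′∈) (∈-tilings⇒avoids (suc o) (suc m) τ′∈)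
∈-tilings⇒avoids o (suc (suc m)) τ∈ | inj₂ τ∈₂ with ∈-map⁻ (domino o) τ∈₂
...   | _ , τ′∈ , refl = avoids-domino (∈-tilings⇒≥ (suc (suc o)) m τ′∈) (∈-tilings⇒avoids (suc (suc o)) m τ′∈)

>1+o : ∀ {o x} → o ≤ x → x ≢ o → x ≢ suc o → suc o < x
>1+o o≤x x≢o x≢1+o = ≤∧≢⇒< (≤∧≢⇒< o≤x (x≢o ∘ sym)) (x≢1+o ∘ sym)

-- otherwise o and o+1 both occur after x and form a 312 or a 321 with it
head-of-tiling : ∀ {o m x τ} → IsPermOf o (suc (suc m)) (x ∷ τ) → Avoids312 (x ∷ τ) → Avoids321 (x ∷ τ) →
                 x ≡ o ⊎ x ≡ suc o
head-of-tiling {o} {m} {x} perm@(isPermOf _ ((o≤x , _) ∷ _) _) av312 av321 with x ≟ o | x ≟ suc o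
... | yes x≡o | _         = inj₁ x≡o
... | no _    | yes x≡1+o = inj₂ x≡1+o
... | no x≢o  | no x≢1+o  with ∈-order (<⇒≢ (n<1+n o)) (∈-∷-≢ (IsPermOf⇒∈ perm (InRange-min o (suc m))) (x≢o ∘ sym))
                                                        (∈-∷-≢ (IsPermOf⇒∈ perm (InRange-2nd o m)) (x≢1+o ∘ sym))
...   | inj₁ o,1+o = ⊥-elim (av312 (refl ∷ o,1+o) (n<1+n o) (>1+o o≤x x≢o x≢1+o))
...   | inj₂ 1+o,o = ⊥-elim (av321 (refl ∷ 1+o,o) (n<1+n o) (>1+o o≤x x≢o x≢1+o))

-- otherwise o occurs later and o+1, y, o is a 231
second-of-tiling : ∀ {o m τ} → IsPermOf o (suc (suc m)) (suc o ∷ τ) → Avoids231 (suc o ∷ τ) → ∃[ τ′ ] τ ≡ o ∷ τ′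
second-of-tiling {o} {m} {y ∷ τ} perm@(isPermOf _ (_ ∷ (o≤y , _) ∷ _) ((1+o≢y ∷ _) ∷ _)) av231 with y ≟ o
... | yes refl = τ , refl
... | no y≢o   = ⊥-elim (av231 (refl ∷ refl ∷ from∈ o∈τ) (n<1+n o) (>1+o o≤y y≢o (1+o≢y ∘ sym)))
  where
  o∈τ : o ∈ τ
  o∈τ = ∈-∷-≢ (∈-∷-≢ (IsPermOf⇒∈ perm (InRange-min o (suc m))) (<⇒≢ (n<1+n o))) (y≢o ∘ sym)

tilings-complete : ∀ o m {τ} → IsPermOf o m τ → Avoids231-312-321 τ → τ ∈ tilings o m
tilings-complete o zero          {[]}         _ _ = here refl
tilings-complete o (suc zero)    {x ∷ []}     (isPermOf _ ((o≤x , x<o+1) ∷ []) _) _ =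
  here (cong [_] (≤-antisym (m<1+n⇒m≤n (subst (x <_) (+-comm o 1) x<o+1)) o≤x))
tilings-complete o (suc (suc m)) {x ∷ τ}      perm av@(_ , av312 , av321) with head-of-tiling perm av312 av321
... | inj₁ refl =
  ∈-++⁺ˡ (∈-map⁺ (o ∷_) (tilings-complete (suc o) (suc m)
    (IsPermOf-++⁻ [ o ] (IsPermOf-∷-min (isPermOf refl [] [])) perm) (avoids-∷⁻ av)))
... | inj₂ refl with second-of-tiling perm (proj₁ av)
...   | τ′ , refl =
  ∈-++⁺ʳ (map (o ∷_) (tilings (suc o) (suc m))) (∈-map⁺ (domino o) (tilings-complete (suc (suc o)) m
    (IsPermOf-++⁻ (domino o []) (IsPermOf-domino (isPermOf refl [] [])) perm) (avoids-∷⁻ (avoids-∷⁻ av))))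
tilings-complete o zero          {_ ∷ _}      (isPermOf () _ _) _
tilings-complete o (suc _)       {[]}         (isPermOf () _ _) _
tilings-complete o (suc zero)    {_ ∷ _ ∷ _}  (isPermOf () _ _) _

tilings-unique : ∀ o m → Unique (tilings o m)
tilings-unique o zero          = [] ∷ []
tilings-unique o (suc zero)    = [] ∷ []
tilings-unique o (suc (suc m)) =
  Unique.++⁺ (Unique.map⁺ (proj₂ ∘ ∷-injective) (tilings-unique (suc o) (suc m)))
             (Unique.map⁺ (proj₂ ∘ ∷-injective ∘ proj₂ ∘ ∷-injective) (tilings-unique (suc (suc o)) m))
             heads-differ
  where
  heads-differ : ∀ {π} → ¬ (π ∈ map (o ∷_) (tilings (suc o) (suc m)) × π ∈ map (domino o) (tilings (suc (suc o)) m))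
  heads-differ (π∈₁ , π∈₂) with ∈-map⁻ (o ∷_) π∈₁ | ∈-map⁻ (domino o) π∈₂
  ... | _ , _ , refl | _ , _ , eq = <⇒≢ (n<1+n o) (proj₁ (∷-injective eq))

-- Counting by inversions

count : ℕ → List (List ℕ) → ℕ
count k πs = length (filter (λ π → inv π ≟ k) πs)

count-++ : ∀ k xs ys → count k (xs ++ ys) ≡ count k xs + count k ys
count-++ k xs ys = trans (cong length (filter-++ (λ π → inv π ≟ k) xs ys)) (length-++ (filter _ xs))

count-map-+ : ∀ (f : List ℕ → List ℕ) c j πs → (∀ {π} → π ∈ πs → inv (f π) ≡ c + inv π) →
              count (c + j) (map f πs) ≡ count j πs
count-map-+ f c j []       _    = refl
count-map-+ f c j (π ∷ πs) inv-f with inv (f π) ≟ c + j | inv π ≟ j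
... | yes p | yes q rewrite filter-accept (λ π → inv π ≟ c + j) {f π} {map f πs} p
                          | filter-accept (λ π → inv π ≟ j) {π} {πs} q = cong suc (count-map-+ f c j πs (inv-f ∘ there))
... | no p  | no q  rewrite filter-reject (λ π → inv π ≟ c + j) {f π} {map f πs} p
                          | filter-reject (λ π → inv π ≟ j) {π} {πs} q = count-map-+ f c j πs (inv-f ∘ there)
... | yes p | no q  = ⊥-elim (q (+-cancelˡ-≡ c _ _ (trans (sym (inv-f (here refl))) p)))
... | no p  | yes q = ⊥-elim (p (trans (inv-f (here refl)) (cong (c +_) q)))

count-map-< : ∀ (f : List ℕ → List ℕ) c k πs → (∀ {π} → π ∈ πs → inv (f π) ≡ c + inv π) → k < c →
              count k (map f πs) ≡ 0
count-map-< f c k []       _     _   = refl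
count-map-< f c k (π ∷ πs) inv-f k<c with inv (f π) ≟ k
... | no p  rewrite filter-reject (λ π → inv π ≟ k) {f π} {map f πs} p = count-map-< f c k πs (inv-f ∘ there) k<c
... | yes p = ⊥-elim (<⇒≱ k<c (≤-trans (m≤m+n c (inv π)) (≤-reflexive (trans (sym (inv-f (here refl))) p))))

inv-∷-min : ∀ {x τ} → All (x <_) τ → inv (x ∷ τ) ≡ inv τ
inv-∷-min {x} x<τ = cong (λ n → length n + _) (filter-none (_<? x) (All.map <⇒≯ x<τ))

inv-domino : ∀ {o τ} → All (suc o <_) τ → inv (domino o τ) ≡ suc (inv τ)
inv-domino {o} {τ} o+1<τ = cong₂ _+_
  (cong length (trans (filter-accept (_<? suc o) (n<1+n o)) (cong (o ∷_) (filter-none (_<? suc o) (All.map <⇒≯ o+1<τ)))))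
  (inv-∷-min (All.map (<-trans (n<1+n o)) o+1<τ))

inv-downFrom-++ : ∀ ℓ {τ} → All (ℓ ≤_) τ → inv (downFrom ℓ ++ τ) ≡ ℓ C 2 + inv τ
inv-downFrom-++ zero          _    = refl
inv-downFrom-++ (suc ℓ) {τ} ℓ<τ = begin
  length (filter (_<? ℓ) (downFrom ℓ ++ τ)) + inv (downFrom ℓ ++ τ)
    ≡⟨ cong₂ _+_ below-ℓ (inv-downFrom-++ ℓ (All.map <⇒≤ ℓ<τ)) ⟩
  ℓ + (ℓ C 2 + inv τ)     ≡⟨ +-assoc ℓ (ℓ C 2) (inv τ) ⟨
  ℓ + ℓ C 2 + inv τ       ≡⟨ cong (λ n → n + ℓ C 2 + inv τ) (nC1≡n ℓ) ⟨
  ℓ C 1 + ℓ C 2 + inv τ   ≡⟨ cong (_+ inv τ) (nCk+nC[k+1]≡[n+1]C[k+1] ℓ 1) ⟩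
  suc ℓ C 2 + inv τ       ∎
  where
  open ≡-Reasoning
  below-ℓ : length (filter (_<? ℓ) (downFrom ℓ ++ τ)) ≡ ℓ
  below-ℓ rewrite filter-++ (_<? ℓ) (downFrom ℓ) τ | filter-all (_<? ℓ) (All.tabulate {xs = downFrom ℓ} ∈-downFrom⁻)
                | filter-none (_<? ℓ) (All.map <⇒≯ ℓ<τ) | length-++ (downFrom ℓ) {[]} =
    trans (+-identityʳ _) (length-downFrom ℓ)

∸C-recurrence : ∀ m j → (suc m ∸ suc j) C suc j + (m ∸ j) C j ≡ (suc (suc m) ∸ suc j) C suc j
∸C-recurrence m j with j ≤? m
... | yes j≤m rewrite +-∸-assoc 1 j≤m = trans (+-comm ((m ∸ j) C suc j) _) (nCk+nC[k+1]≡[n+1]C[k+1] (m ∸ j) j)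
... | no j≰m rewrite m≤n⇒m∸n≡0 (≰⇒≥ j≰m) | m≤n⇒m∸n≡0 (≰⇒> j≰m) = cong (0 C suc j +_) (k>n⇒nCk≡0 (≤-<-trans z≤n (≰⇒> j≰m)))

count-tilings : ∀ o m j → count j (tilings o m) ≡ (m ∸ j) C j
count-tilings o zero          zero    = refl
count-tilings o zero          (suc j) = refl
count-tilings o (suc zero)    zero    = refl
count-tilings o (suc zero)    (suc j) rewrite 0∸n≡0 j = refl
count-tilings o (suc (suc m)) j = begin
  count j (map (o ∷_) T₁ ++ map (domino o) T₂)           ≡⟨ count-++ j (map (o ∷_) T₁) (map (domino o) T₂) ⟩
  count j (map (o ∷_) T₁) + count j (map (domino o) T₂)  ≡⟨ cong (_+ count j (map (domino o) T₂)) monominoes ⟩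
  count j T₁ + count j (map (domino o) T₂)               ≡⟨ cong (_+ count j (map (domino o) T₂)) (count-tilings (suc o) (suc m) j) ⟩
  (suc m ∸ j) C j + count j (map (domino o) T₂)          ≡⟨ dominoes j ⟩
  (suc (suc m) ∸ j) C j                                  ∎
  where
  open ≡-Reasoning
  T₁ = tilings (suc o) (suc m)
  T₂ = tilings (suc (suc o)) m
  monominoes : count j (map (o ∷_) T₁) ≡ count j T₁
  monominoes = count-map-+ (o ∷_) 0 j T₁ (inv-∷-min ∘ ∈-tilings⇒≥ (suc o) (suc m))
  inv-domino-T₂ : ∀ {τ} → τ ∈ T₂ → inv (domino o τ) ≡ 1 + inv τ
  inv-domino-T₂ = inv-domino ∘ ∈-tilings⇒≥ (suc (suc o)) m
  dominoes : ∀ j → (suc m ∸ j) C j + count j (map (domino o) T₂) ≡ (suc (suc m) ∸ j) C j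
  dominoes zero    rewrite count-map-< (domino o) 1 0 T₂ inv-domino-T₂ (s≤s z≤n) = refl
  dominoes (suc j) rewrite count-map-+ (domino o) 1 j T₂ inv-domino-T₂ | count-tilings (suc (suc o)) m j = ∸C-recurrence m j

-- The structure of Av(231, 312, 1432)

shapes : ℕ → ℕ → List (List ℕ)
shapes N zero    = []
shapes N (suc ℓ) = shapes N ℓ ++ map (downFrom (suc ℓ) ++_) (tilings (suc ℓ) (N ∸ suc ℓ))

∈-shapes⁺ : ∀ N L ℓ {τ} → ℓ < L → τ ∈ tilings (suc ℓ) (N ∸ suc ℓ) → downFrom (suc ℓ) ++ τ ∈ shapes N L
∈-shapes⁺ N (suc L) ℓ ℓ<1+L τ∈ with m<1+n⇒m<n∨m≡n ℓ<1+L
... | inj₁ ℓ<L  = ∈-++⁺ˡ (∈-shapes⁺ N L ℓ ℓ<L τ∈)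
... | inj₂ refl = ∈-++⁺ʳ (shapes N ℓ) (∈-map⁺ (downFrom (suc ℓ) ++_) τ∈)

∈-shapes⁻ : ∀ N L {π} → π ∈ shapes N L →
            ∃[ ℓ ] ℓ < L × ∃[ τ ] τ ∈ tilings (suc ℓ) (N ∸ suc ℓ) × π ≡ downFrom (suc ℓ) ++ τ
∈-shapes⁻ N (suc L) π∈ with ∈-++⁻ (shapes N L) π∈
... | inj₁ π∈′ with ∈-shapes⁻ N L π∈′
...   | ℓ , ℓ<L , τ , τ∈ , eq = ℓ , m<n⇒m<1+n ℓ<L , τ , τ∈ , eq
∈-shapes⁻ N (suc L) π∈ | inj₂ π∈′ with ∈-map⁻ (downFrom (suc L) ++_) π∈′
...   | τ , τ∈ , eq = L , n<1+n L , τ , τ∈ , eq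

shapes-unique : ∀ N L → Unique (shapes N L)
shapes-unique N zero    = []
shapes-unique N (suc L) =
  Unique.++⁺ (shapes-unique N L)
             (Unique.map⁺ (++-cancelˡ (downFrom (suc L)) _ _) (tilings-unique (suc L) (N ∸ suc L)))
             heads-differ
  where
  heads-differ : ∀ {π} → ¬ (π ∈ shapes N L × π ∈ map (downFrom (suc L) ++_) (tilings (suc L) (N ∸ suc L)))
  heads-differ (π∈₁ , π∈₂) with ∈-shapes⁻ N L π∈₁ | ∈-map⁻ (downFrom (suc L) ++_) π∈₂
  ... | ℓ , ℓ<L , _ , _ , refl | _ , _ , eq = <⇒≢ ℓ<L (proj₁ (∷-injective eq))

⊆-drop-downFrom : ∀ k {b s ys} → k ≤ b → b ∷ s ⊆ downFrom k ++ ys → b ∷ s ⊆ ys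
⊆-drop-downFrom zero    _   τ          = τ
⊆-drop-downFrom (suc k) k<b (refl ∷ _) = ⊥-elim (<-irrefl refl k<b)
⊆-drop-downFrom (suc k) k<b (_ ∷ʳ τ)   = ⊆-drop-downFrom k (<⇒≤ k<b) τ

pair-⊆-downFrom-++ : ∀ k {b c ys} → b ∷ c ∷ [] ⊆ downFrom k ++ ys → c < b ⊎ c ∈ ys
pair-⊆-downFrom-++ zero    τ = inj₂ (2nd∈ τ)
pair-⊆-downFrom-++ (suc k) (_ ∷ʳ τ) = pair-⊆-downFrom-++ k τ
pair-⊆-downFrom-++ (suc k) (refl ∷ τ) with ∈-++⁻ (downFrom k) (to∈ τ)
... | inj₁ c∈ = inj₁ (∈-downFrom⁻ c∈)
... | inj₂ c∈ = inj₂ c∈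

downFrom-++-avoids : ∀ k {τ} → All (k ≤_) τ → Avoids231-312-321 τ → AvoidsB₁ (downFrom k ++ τ)
downFrom-++-avoids zero    _   (av231 , av312 , av321) = av231 , av312 , λ τ _ → av321 (∷⁻ τ)
  where
  ∷⁻ : ∀ {a s xs} → a ∷ s ⊆ xs → s ⊆ xs
  ∷⁻ τ = ⊆-trans (_ ∷ʳ ⊆-refl) τ
downFrom-++-avoids (suc k) {τ} k<τ av@(_ , _ , av321) with downFrom-++-avoids k (All.map <⇒≤ k<τ) av
... | av231 , av312 , av1432 = av231′ , av312′ , av1432′
  where
  av231′ : Avoids231 (downFrom (suc k) ++ τ)
  av231′ (refl ∷ τ′) c<a a<b = ∈-above⇒≮ k<τ (2nd∈ (⊆-drop-downFrom k (<⇒≤ a<b) τ′)) c<a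
  av231′ (_ ∷ʳ τ′)   c<a a<b = av231 τ′ c<a a<b
  av312′ : Avoids312 (downFrom (suc k) ++ τ)
  av312′ (refl ∷ τ′) b<c c<a with pair-⊆-downFrom-++ k τ′
  ... | inj₁ c<b = <-asym b<c c<b
  ... | inj₂ c∈τ = ∈-above⇒≮ k<τ c∈τ c<a
  av312′ (_ ∷ʳ τ′)   b<c c<a = av312 τ′ b<c c<a
  av1432′ : Avoids1432 (downFrom (suc k) ++ τ)
  av1432′ (refl ∷ τ′) a<d d<c c<b = av321 (⊆-drop-downFrom k (<⇒≤ (<-trans a<d (<-trans d<c c<b))) τ′) d<c c<b
  av1432′ (_ ∷ʳ τ′)   a<d d<c c<b = av1432 τ′ a<d d<c c<b

∈-shapes⇒avoider : ∀ N {π} → π ∈ shapes N N → IsPermOf 0 N π × AvoidsB₁ π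
∈-shapes⇒avoider N π∈ with ∈-shapes⁻ N N π∈
... | ℓ , ℓ<N , τ , τ∈ , refl =
  subst (λ m → IsPermOf 0 m (downFrom (suc ℓ) ++ τ)) (m+[n∸m]≡n ℓ<N) (IsPermOf-++⁺ (IsPermOf-downFrom (suc ℓ)) perm-τ) ,
  downFrom-++-avoids (suc ℓ) (∈-tilings⇒≥ (suc ℓ) (N ∸ suc ℓ) τ∈) (∈-tilings⇒avoids (suc ℓ) (N ∸ suc ℓ) τ∈)
  where
  perm-τ : IsPermOf (suc ℓ + 0) (N ∸ suc ℓ) τ
  perm-τ = subst (λ o → IsPermOf o (N ∸ suc ℓ) τ) (sym (+-identityʳ (suc ℓ))) (∈-tilings⇒IsPermOf (suc ℓ) (N ∸ suc ℓ) τ∈)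

downFrom-prefix : ∀ a xs → (∀ {v} → v < a → v ∈ xs) → Unique (a ∷ xs) → Avoids231 (a ∷ xs) → Avoids312 (a ∷ xs) →
                  ∃[ ys ] xs ≡ downFrom a ++ ys × All (a <_) ys
downFrom-prefix zero    xs       _      (0∉xs ∷ _) _     _     = xs , refl , All.map (n≢0⇒n>0 ∘ (_∘ sym)) 0∉xs
downFrom-prefix (suc a) []       covers _          _     _     with covers (n<1+n a)
... | ()
downFrom-prefix (suc a) (h ∷ xs) covers ((1+a≢h ∷ 1+a∉xs) ∷ u) av231 av312 with h ≟ a
... | yes refl with downFrom-prefix a xs (λ v<a → ∈-∷-≢ (covers (m<n⇒m<1+n v<a)) (<⇒≢ v<a))
                                    u (av231 ∘ (suc a ∷ʳ_)) (av312 ∘ (suc a ∷ʳ_))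
...   | ys , refl , a<ys = ys , refl , All.tabulate λ y∈ys →
          ≤∧≢⇒< (All.lookup a<ys y∈ys) (All.lookup 1+a∉xs (∈-++⁺ʳ (downFrom a) y∈ys))
downFrom-prefix (suc a) (h ∷ xs) covers ((1+a≢h ∷ _) ∷ _) av231 av312 | no h≢a
  with ∈-∷-≢ (covers (n<1+n a)) (h≢a ∘ sym) | h <? a
... | a∈xs | yes h<a = ⊥-elim (av312 (refl ∷ refl ∷ from∈ a∈xs) h<a (n<1+n a))
... | a∈xs | no h≮a  = ⊥-elim (av231 (refl ∷ refl ∷ from∈ a∈xs) (n<1+n a) (≤∧≢⇒< (≮∧≢⇒> h≮a h≢a) 1+a≢h))

avoider⇒∈-shapes : ∀ N {π} → IsPermOf 0 (suc N) π → AvoidsB₁ π → π ∈ shapes (suc N) (suc N)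
avoider⇒∈-shapes N {[]}     (isPermOf () _ _) _
avoider⇒∈-shapes N {a ∷ xs} perm@(isPermOf _ ((_ , a<N) ∷ _) u) (av231 , av312 , av1432)
  with downFrom-prefix a xs (λ v<a → ∈-∷-≢ (IsPermOf⇒∈ perm (z≤n , <-trans v<a a<N)) (<⇒≢ v<a)) u av231 av312
... | ys , refl , a<ys = ∈-shapes⁺ (suc N) (suc N) a a<N (tilings-complete (suc a) (suc N ∸ suc a) perm-ys avoids-ys)
  where
  ys⊆π : ys ⊆ downFrom (suc a) ++ ys
  ys⊆π = ++⁺ˡ (downFrom (suc a)) ⊆-refl
  perm-ys : IsPermOf (suc a) (suc N ∸ suc a) ys
  perm-ys = subst (λ o → IsPermOf o (suc N ∸ suc a) ys) (+-identityʳ (suc a))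
              (IsPermOf-++⁻ (downFrom (suc a)) (IsPermOf-downFrom (suc a))
                (subst (λ m → IsPermOf 0 m (downFrom (suc a) ++ ys)) (sym (m+[n∸m]≡n a<N)) perm))
  avoids-ys : Avoids231-312-321 ys
  avoids-ys = (λ τ → av231 (⊆-trans τ ys⊆π)) , (λ τ → av312 (⊆-trans τ ys⊆π)) ,
              λ τ c<b b<a → av1432 (refl ∷ ++⁺ˡ (downFrom a) τ) (a<3rd τ) c<b b<a
    where
    a<3rd : ∀ {x y z} → x ∷ y ∷ z ∷ [] ⊆ ys → a < z
    a<3rd τ = All.lookup a<ys (lookup τ (there (there (here refl))))

-- The formula

summand : ℕ → ℕ → ℕ → ℕ
summand N k ℓ = let j = (ℤ.+ k) ℤ.- (ℤ.+ (ℓ C 2)) in binomℤ (((ℤ.+ N) ℤ.- (ℤ.+ ℓ)) ℤ.- j) j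

binomℤ-⊖ : ∀ m j → binomℤ (m ⊖ j) (ℤ.+ j) ≡ (m ∸ j) C j
binomℤ-⊖ m j with j ≤? m
... | yes j≤m rewrite ℤ.⊖-≥ j≤m = refl
... | no j≰m  rewrite ℤ.⊖-< (≰⇒> j≰m) | m≤n⇒m∸n≡0 (≰⇒≥ j≰m) with j ∸ m | m<n⇒0<n∸m (≰⇒> j≰m)
...   | suc _ | _ = sym (k>n⇒nCk≡0 (≤-<-trans z≤n (≰⇒> j≰m)))

binomℤ-<0 : ∀ x {k c} → k < c → binomℤ x ((ℤ.+ k) ℤ.- (ℤ.+ c)) ≡ 0
binomℤ-<0 x {k} {c} k<c rewrite ℤ.m-n≡m⊖n k c | ℤ.⊖-< k<c with c ∸ k | m<n⇒0<n∸m k<c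
binomℤ-<0 (ℤ.+ _)      k<c | suc _ | _ = refl
binomℤ-<0 ℤ.-[1+ _ ]   k<c | suc _ | _ = refl

summand-< : ∀ N k ℓ → k < ℓ C 2 → summand N k ℓ ≡ 0
summand-< N k ℓ = binomℤ-<0 (((ℤ.+ N) ℤ.- (ℤ.+ ℓ)) ℤ.- ((ℤ.+ k) ℤ.- (ℤ.+ (ℓ C 2))))

summand-≥ : ∀ N k ℓ → ℓ ≤ N → ℓ C 2 ≤ k → summand N k ℓ ≡ ((N ∸ ℓ) ∸ (k ∸ ℓ C 2)) C (k ∸ ℓ C 2)
summand-≥ N k ℓ ℓ≤N c≤k
  rewrite ℤ.m-n≡m⊖n k (ℓ C 2) | ℤ.⊖-≥ c≤k | ℤ.m-n≡m⊖n N ℓ | ℤ.⊖-≥ ℓ≤N | ℤ.m-n≡m⊖n (N ∸ ℓ) (k ∸ ℓ C 2) =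
  binomℤ-⊖ (N ∸ ℓ) (k ∸ ℓ C 2)

inv-shape : ∀ ℓ m {τ} → τ ∈ tilings ℓ m → inv (downFrom ℓ ++ τ) ≡ ℓ C 2 + inv τ
inv-shape ℓ m = inv-downFrom-++ ℓ ∘ ∈-tilings⇒≥ ℓ m

count-block : ∀ N k ℓ → ℓ ≤ N → count k (map (downFrom ℓ ++_) (tilings ℓ (N ∸ ℓ))) ≡ summand N k ℓ
count-block N k ℓ ℓ≤N with k <? ℓ C 2
... | yes k<c = trans (count-map-< (downFrom ℓ ++_) (ℓ C 2) k (tilings ℓ (N ∸ ℓ)) (inv-shape ℓ (N ∸ ℓ)) k<c)
                      (sym (summand-< N k ℓ k<c))
... | no k≮c = begin
  count k (map (downFrom ℓ ++_) T)                      ≡⟨ cong (λ k → count k (map (downFrom ℓ ++_) T)) (m+[n∸m]≡n c≤k) ⟨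
  count (ℓ C 2 + (k ∸ ℓ C 2)) (map (downFrom ℓ ++_) T)  ≡⟨ count-map-+ (downFrom ℓ ++_) (ℓ C 2) (k ∸ ℓ C 2) T (inv-shape ℓ (N ∸ ℓ)) ⟩
  count (k ∸ ℓ C 2) T                                   ≡⟨ count-tilings ℓ (N ∸ ℓ) (k ∸ ℓ C 2) ⟩
  ((N ∸ ℓ) ∸ (k ∸ ℓ C 2)) C (k ∸ ℓ C 2)                 ≡⟨ summand-≥ N k ℓ ℓ≤N c≤k ⟨
  summand N k ℓ                                         ∎
  where
  open ≡-Reasoning
  T = tilings ℓ (N ∸ ℓ)
  c≤k = ≮⇒≥ k≮c

count-shapes : ∀ N k L → L ≤ N → count k (shapes N L) ≡ sumFrom1 L (summand N k)
count-shapes N k zero    _   = refl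
count-shapes N k (suc L) L<N =
  trans (count-++ k (shapes N L) _) (cong₂ _+_ (count-shapes N k L (<⇒≤ L<N)) (count-block N k (suc L) L<N))

theorem3p5 : (n k : ℕ) → countInv (suc n) B₁ k ≡ rhs (suc n) k
theorem3p5 n k = begin
  count k (Av N B₁)     ≡⟨ unique⇒length-≡ (Unique.filter⁺ P? (Av-unique N)) (Unique.filter⁺ P? (shapes-unique N N))
                             (filter-mono avoider⇒shape) (filter-mono shape⇒avoider) ⟩
  count k (shapes N N)  ≡⟨ count-shapes N k N ≤-refl ⟩
  rhs N k               ∎
  where
  open ≡-Reasoning
  N = suc n
  P? = λ π → inv π ≟ k
  filter-mono : ∀ {xs ys} → (∀ {π} → π ∈ xs → π ∈ ys) → ∀ {π} → π ∈ filter P? xs → π ∈ filter P? ys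
  filter-mono {xs} xs⊆ys π∈ with ∈-filter⁻ P? {xs = xs} π∈
  ... | π∈xs , p = ∈-filter⁺ P? (xs⊆ys π∈xs) p
  avoider⇒shape : ∀ {π} → π ∈ Av N B₁ → π ∈ shapes N N
  avoider⇒shape π∈ = let perm , av = ∈-Av⁻ N π∈ in avoider⇒∈-shapes n perm av
  shape⇒avoider : ∀ {π} → π ∈ shapes N N → π ∈ Av N B₁
  shape⇒avoider π∈ = let perm , av = ∈-shapes⇒avoider N π∈ in ∈-Av⁺ N perm av
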